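{- For every positive integer $n$ there exist a positive integer $x_1$ and a positive integer $m$ such that for every $i \in \{0,1,\dots,n-1\}$ we have $Col^{i+1}(x_1) < Col^{i}(x_1)$ and the step size of $Col^{i}(x_1)$ equals $m$.
   Context: The Collatz map $Col$ on the positive integers is defined as follows. If $x$ is odd, $Col(x) = (3x+1)/2^{m}$, where $m \ge 1$ is the exponent of the largest power of $2$ dividing $3x+1$; if $x$ is even, $Col(x) = x/2^{m}$, where $m \ge 1$ is the exponent of the largest power of $2$ dividing $x$. In either case this exponent $m$ is called the step size of $x$. $Col^{0}(x) = x$ and $Col^{i+1}(x) = Col(Col^{i}(x))$. -}

module Defs where

open import Data.Nat using (ℕ; zero; suc; _+_; _*_; _^_)
open import Data.Nat.Divisibility using (_∣_; _∣?_)
open import Data.Bool using (Bool; true; false; if_then_else_)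
open import Relation.Nullary using (does)

isEven : ℕ → Bool
isEven zero = true
isEven (suc zero) = false
isEven (suc (suc n)) = isEven n

half : ℕ → ℕ
half zero = zero
half (suc zero) = zero
half (suc (suc n)) = suc (half n)

ν₂-fuel : ℕ → ℕ → ℕ
ν₂-fuel zero y = zero
ν₂-fuel (suc f) zero = zero
ν₂-fuel (suc f) y@(suc _) = if isEven y then suc (ν₂-fuel f (half y)) else zero

-- 2-adic valuation of a positive integer y (fuel y suffices since 2^k ≤ y);
-- ν₂ 0 = 0 by convention (never used: the argument is always positive below).
ν₂ : ℕ → ℕ
ν₂ y = ν₂-fuel y y

oddPart-fuel : ℕ → ℕ → ℕ
oddPart-fuel zero y = y
oddPart-fuel (suc f) zero = zero
oddPart-fuel (suc f) y@(suc _) = if isEven y then oddPart-fuel f (half y) else y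

oddPart : ℕ → ℕ
oddPart y = oddPart-fuel y y

pre : ℕ → ℕ
pre x = if isEven x then x else 3 * x + 1

stepSize : ℕ → ℕ
stepSize x = ν₂ (pre x)

Col : ℕ → ℕ
Col x = oddPart (pre x)

Col^ : ℕ → ℕ → ℕ
Col^ zero x = x
Col^ (suc i) x = Col (Col^ i x)

{-# OPTIONS --safe #-}
-- The odd numbers 1 + 2·3ⁱ·4ᵏ form a descending chain under Col: since
-- 3(1 + 2·3ⁱ·4ᵏ⁺¹) + 1 = 4(1 + 2·3ⁱ⁺¹·4ᵏ), each step divides by exactly 4
-- and trades a factor 4 for a factor 3. Starting from x₁ = 1 + 2·4ⁿ the
-- first n steps therefore all have step size 2 and all decrease.
module Submission where

open import Defs
open import Data.Nat using (ℕ; zero; suc; _+_; _*_; _^_; _<_; _≤_; s≤s; z≤n; >-nonZero⁻¹)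
open import Data.Nat.Properties
open import Data.Bool using (true; false)
open import Data.Product using (∃; ∃-syntax; _×_; _,_)
open import Relation.Binary.PropositionalEquality
  using (_≡_; refl; sym; trans; cong; subst₂; module ≡-Reasoning)
open import Data.Nat.Tactic.RingSolver using (solve-∀)

-- 2 * suc a normalises to suc (a + suc (a + 0)); +-suc exposes the second suc.
isEven-double : ∀ a → isEven (2 * a) ≡ true
isEven-double zero = refl
isEven-double (suc a) rewrite +-suc a (a + 0) = isEven-double a

isEven-odd : ∀ a → isEven (1 + 2 * a) ≡ false
isEven-odd zero = refl
isEven-odd (suc a) rewrite +-suc a (a + 0) = isEven-odd a

half-double : ∀ a → half (2 * a) ≡ a
half-double zero = refl
half-double (suc a) rewrite +-suc a (a + 0) = cong suc (half-double a)

ν₂-fuel-double : ∀ f a → 0 < a → ν₂-fuel (suc f) (2 * a) ≡ suc (ν₂-fuel f a)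
ν₂-fuel-double f (suc b) _ rewrite +-suc b (b + 0) | isEven-double b | half-double b = refl

oddPart-fuel-double : ∀ f a → 0 < a → oddPart-fuel (suc f) (2 * a) ≡ oddPart-fuel f a
oddPart-fuel-double f (suc b) _ rewrite +-suc b (b + 0) | isEven-double b | half-double b = refl

2^j*odd>0 : ∀ j w → 0 < 2 ^ j * (1 + 2 * w)
2^j*odd>0 j w = >-nonZero⁻¹ _ {{m*n≢0 (2 ^ j) (1 + 2 * w) {{m^n≢0 2 j}}}}

2^suc-j*odd : ∀ j w → 2 ^ suc j * (1 + 2 * w) ≡ 2 * (2 ^ j * (1 + 2 * w))
2^suc-j*odd j w = *-assoc 2 (2 ^ j) (1 + 2 * w)

ν₂-fuel-2^j*odd : ∀ j f w → j < f → ν₂-fuel f (2 ^ j * (1 + 2 * w)) ≡ j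
ν₂-fuel-2^j*odd zero (suc f) w _ rewrite +-identityʳ (1 + 2 * w) | isEven-odd w = refl
ν₂-fuel-2^j*odd (suc j) (suc f) w (s≤s j<f)
  rewrite 2^suc-j*odd j w | ν₂-fuel-double f _ (2^j*odd>0 j w) =
  cong suc (ν₂-fuel-2^j*odd j f w j<f)

oddPart-fuel-2^j*odd : ∀ j f w → j ≤ f → oddPart-fuel f (2 ^ j * (1 + 2 * w)) ≡ 1 + 2 * w
oddPart-fuel-2^j*odd zero zero w _ = +-identityʳ (1 + 2 * w)
oddPart-fuel-2^j*odd zero (suc f) w _ rewrite +-identityʳ (1 + 2 * w) | isEven-odd w = refl
oddPart-fuel-2^j*odd (suc j) (suc f) w (s≤s j≤f)
  rewrite 2^suc-j*odd j w | oddPart-fuel-double f _ (2^j*odd>0 j w) =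
  oddPart-fuel-2^j*odd j f w j≤f

n<2^n : ∀ n → n < 2 ^ n
n<2^n zero = s≤s z≤n
n<2^n (suc n) = ≤-<-trans (n<2^n n) (^-monoʳ-< 2 (s≤s (s≤s z≤n)) (n<1+n n))

j<2^j*odd : ∀ j w → j < 2 ^ j * (1 + 2 * w)
j<2^j*odd j w = <-≤-trans (n<2^n j) (m≤m*n (2 ^ j) (1 + 2 * w))

ν₂-2^j*odd : ∀ j w → ν₂ (2 ^ j * (1 + 2 * w)) ≡ j
ν₂-2^j*odd j w = ν₂-fuel-2^j*odd j _ w (j<2^j*odd j w)

oddPart-2^j*odd : ∀ j w → oddPart (2 ^ j * (1 + 2 * w)) ≡ 1 + 2 * w
oddPart-2^j*odd j w = oddPart-fuel-2^j*odd j _ w (<⇒≤ (j<2^j*odd j w))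

module _ (v j w : ℕ) (3x+1≡2^j*odd : 3 * (1 + 2 * v) + 1 ≡ 2 ^ j * (1 + 2 * w)) where

  pre-odd : pre (1 + 2 * v) ≡ 2 ^ j * (1 + 2 * w)
  pre-odd rewrite isEven-odd v = 3x+1≡2^j*odd

  Col-odd : Col (1 + 2 * v) ≡ 1 + 2 * w
  Col-odd rewrite pre-odd = oddPart-2^j*odd j w

  stepSize-odd : stepSize (1 + 2 * v) ≡ j
  stepSize-odd rewrite pre-odd = ν₂-2^j*odd j w

orbit : ℕ → ℕ → ℕ
orbit k i = 1 + 2 * (3 ^ i * 4 ^ k)

3*orbit+1 : ∀ k i → 3 * orbit (suc k) i + 1 ≡ 2 ^ 2 * orbit k (suc i)
3*orbit+1 k i = identity (3 ^ i) (4 ^ k)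
  where
  identity : ∀ p q → 3 * (1 + 2 * (p * (4 * q))) + 1 ≡ 2 ^ 2 * (1 + 2 * (3 * p * q))
  identity = solve-∀

Col-orbit : ∀ k i → Col (orbit (suc k) i) ≡ orbit k (suc i)
Col-orbit k i = Col-odd (3 ^ i * 4 ^ suc k) 2 (3 ^ suc i * 4 ^ k) (3*orbit+1 k i)

stepSize-orbit : ∀ k i → stepSize (orbit (suc k) i) ≡ 2
stepSize-orbit k i = stepSize-odd (3 ^ i * 4 ^ suc k) 2 (3 ^ suc i * 4 ^ k) (3*orbit+1 k i)

orbit-decreasing : ∀ k i → orbit k (suc i) < orbit (suc k) i
orbit-decreasing k i = s≤s (*-monoʳ-< 2 3pq<4pq)
  where
  p = 3 ^ i
  q = 4 ^ k
  3pq<4pq : 3 * p * q < p * (4 * q)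
  3pq<4pq = subst₂ _<_ (reassoc-3 p q) (reassoc-4 p q) (*-monoˡ-< (p * q) {{m*n≢0 p q {{m^n≢0 3 i}} {{m^n≢0 4 k}}}} (n<1+n 3))
    where
    reassoc-3 : ∀ p q → 3 * (p * q) ≡ 3 * p * q
    reassoc-3 = solve-∀
    reassoc-4 : ∀ p q → 4 * (p * q) ≡ p * (4 * q)
    reassoc-4 = solve-∀

Col^-orbit : ∀ i k → Col^ i (orbit (i + k) 0) ≡ orbit k i
Col^-orbit zero k = refl
Col^-orbit (suc i) k = begin
  Col (Col^ i (orbit (suc i + k) 0)) ≡⟨ cong (λ t → Col (Col^ i (orbit t 0))) (sym (+-suc i k)) ⟩
  Col (Col^ i (orbit (i + suc k) 0)) ≡⟨ cong Col (Col^-orbit i (suc k)) ⟩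
  Col (orbit (suc k) i)              ≡⟨ Col-orbit k i ⟩
  orbit k (suc i)                    ∎
  where open ≡-Reasoning

Col^-+1 : ∀ i x → Col^ (i + 1) x ≡ Col (Col^ i x)
Col^-+1 i x = cong (λ t → Col^ t x) (+-comm i 1)

theorem2 : ∀ (n : ℕ) → 0 < n →
    ∃[ x₁ ] ∃[ m ] (0 < x₁ × 0 < m ×
      (∀ (i : ℕ) → i < n →
        (Col^ (i + 1) x₁ < Col^ i x₁) × (stepSize (Col^ i x₁) ≡ m)))
theorem2 n _ = orbit n 0 , 2 , s≤s z≤n , s≤s z≤n , descends
  where
  descends : ∀ i → i < n →
    (Col^ (i + 1) (orbit n 0) < Col^ i (orbit n 0)) × (stepSize (Col^ i (orbit n 0)) ≡ 2)
  descends i i<n with m≤n⇒∃[o]m+o≡n i<n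
  ... | k , refl = subst₂ _<_ (sym next) (sym here) (orbit-decreasing k i)
                  , trans (cong stepSize here) (stepSize-orbit k i)
    where
    here : Col^ i (orbit (suc i + k) 0) ≡ orbit (suc k) i
    here = trans (cong (λ t → Col^ i (orbit t 0)) (sym (+-suc i k))) (Col^-orbit i (suc k))
    next : Col^ (i + 1) (orbit (suc i + k) 0) ≡ orbit k (suc i)
    next = trans (Col^-+1 i _) (trans (cong Col here) (Col-orbit k i))
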